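{- The iterated symmetric derivatives $\mathbf D_1,\mathbf D_2,\dots$, viewed as commuting linear operators on $\Lambda$, are algebraically independent over $\mathbb C$.
   Context: $\Lambda$ is the algebra of symmetric functions over $\mathbb C$ in variables $y_1,y_2,\dots$ with monomial basis $m_\lambda$. For $i\ge1$, $\mathbf D_i m_\lambda=i!\,m_{\lambda\setminus i}$ if $i$ is a part of $\lambda$ ($\lambda\setminus i$ removes one part $i$) and $\mathbf D_i m_\lambda=0$ otherwise. -}

module Defs where

open import Level using (Level; _⊔_)
open import Data.Nat as ℕ using (ℕ; zero; suc; _<_; _≤_; _≥_; _≟_)
open import Data.Nat.Base using (_!)
open import Data.List using (List; []; _∷_; concatMap; map)
open import Data.List.Properties using (≡-dec)
open import Data.List.Relation.Unary.All using (All)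
open import Data.List.Relation.Unary.Linked using (Linked)
open import Data.Maybe using (Maybe; just; nothing)
open import Data.Vec as Vec using (Vec)
open import Data.Product using (_×_; _,_; Σ)
open import Relation.Nullary using (¬_; yes; no)
open import Algebra.Bundles using (CommutativeRing)

-- Ground field: a field of characteristic 0 (stand-in for ℂ)

ringFromℕ : ∀ {c ℓ} (R : CommutativeRing c ℓ) → ℕ → CommutativeRing.Carrier R
ringFromℕ R zero    = CommutativeRing.0# R
ringFromℕ R (suc n) = CommutativeRing._+_ R (CommutativeRing.1# R) (ringFromℕ R n)

record CharZeroField (c ℓ : Level) : Set (Level.suc (c ⊔ ℓ)) where
  field
    cring : CommutativeRing c ℓ
  open CommutativeRing cring public
  field
    inverse  : ∀ x → ¬ (x ≈ 0#) → Σ Carrier (λ y → x * y ≈ 1#)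
    charZero : ∀ n → ¬ (ringFromℕ cring (suc n) ≈ 0#)

  fromℕ : ℕ → Carrier
  fromℕ = ringFromℕ cring

Partition : Set
Partition = List ℕ

IsPartition : Partition → Set
IsPartition p = All (0 <_) p × Linked _≥_ p

removePart : ℕ → Partition → Maybe Partition
removePart i []       = nothing
removePart i (x ∷ xs) with i ≟ x
... | yes _ = just xs
... | no  _ with removePart i xs
...   | nothing = nothing
...   | just ys = just (x ∷ ys)

-- Λ over F, elements written as finite formal linear combinations
-- Σ c · m_λ  (a list of pairs (c , λ)), and the operators D_i.

module SymFun {c ℓ} (F : CharZeroField c ℓ) where
  open CharZeroField F

  Λ : Set c
  Λ = List (Carrier × Partition)

  m : Partition → Λ
  m p = (1# , p) ∷ []

  coeff : Partition → Λ → Carrier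
  coeff μ []             = 0#
  coeff μ ((a , p) ∷ xs) with ≡-dec _≟_ p μ
  ... | yes _ = a + coeff μ xs
  ... | no  _ = coeff μ xs

  scale : Carrier → Λ → Λ
  scale a = map (λ { (b , p) → (a * b , p) })

  D : ℕ → Λ → Λ
  D i = concatMap step
    where
    step : Carrier × Partition → Λ
    step (a , p) with removePart i p
    ... | nothing = []
    ... | just q  = (fromℕ (i !) * a , q) ∷ []

  Dpow : ℕ → ℕ → Λ → Λ
  Dpow i zero    x = x
  Dpow i (suc k) x = D i (Dpow i k x)

  DmonoFrom : ∀ {n} → ℕ → Vec ℕ n → Λ → Λ
  DmonoFrom j Vec.[]       x = x
  DmonoFrom j (a Vec.∷ α)  x = Dpow j a (DmonoFrom (suc j) α x)

  Dmono : ∀ {n} → Vec ℕ n → Λ → Λ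
  Dmono = DmonoFrom 1

  box : (n d : ℕ) → List (Vec ℕ n)
  box zero    d = Vec.[] ∷ []
  box (suc n) d = concatMap (λ a → map (a Vec.∷_) (box n d)) (Data.List.upTo (suc d))
    where import Data.List

  -- P(D_1,…,D_n) applied to x, where P = Σ_{α ∈ box n d} coef α · y^α
  applyPoly : (n d : ℕ) → (Vec ℕ n → Carrier) → Λ → Λ
  applyPoly n d coef x = concatMap (λ α → scale (coef α) (Dmono α x)) (box n d)

{-# OPTIONS --safe #-}
module Submission where

-- Let P be a polynomial with coefficients c_α for α in a box, and let λ(α) be the partition with
-- α_i parts equal to i.  A monomial D_{r_1} ⋯ D_{r_k} sends m_p to a nonzero multiple of m_q
-- when p = {r_1, …, r_k} ⊎ q as multisets, and to 0 when no such q exists.  So the coefficient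
-- of m_∅ in D^β m_{λ(α)} is nonzero exactly when β = α, and the coefficient of m_∅ in
-- P(D) m_{λ(α)} is c_α times a nonzero scalar; if P(D) = 0, every c_α vanishes.

open import Defs
open import Level using (_⊔_)
open import Data.Nat using (ℕ; zero; suc; _≤_; _≥_; _≟_; _<?_; s≤s; NonZero)
open import Data.Nat.Base using (_!)
open import Data.Nat.Properties using (≤-refl; <⇒≤; n≮n; _!≢0)
open import Data.List using (List; []; _∷_; [_]; _++_; replicate; filter; concatMap; map; upTo)
open import Data.List.Properties using (≡-dec; ++-assoc; ++-identityʳ; concatMap-++; concatMap-cong; concatMap-map; filter-++; filter-all; filter-none; length-replicate)
open import Data.List.Membership.Propositional using (_∈_; _∉_)
open import Data.List.Membership.Propositional.Properties using (∈-upTo⁺)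
open import Data.List.Relation.Unary.All as ListAll using ([]; _∷_)
open import Data.List.Relation.Unary.All.Properties using (++⁺; replicate⁺)
open import Data.List.Relation.Unary.AllPairs using (AllPairs; []; _∷_)
import Data.List.Relation.Unary.AllPairs.Properties as AllPairs
open import Data.List.Relation.Unary.Any using (here; there)
open import Data.List.Relation.Unary.Linked.Properties using (AllPairs⇒Linked)
open import Data.List.Relation.Unary.Unique.Propositional using (Unique)
open import Data.List.Relation.Unary.Unique.Propositional.Properties using (upTo⁺)
open import Data.List.Relation.Binary.Permutation.Propositional using (_↭_; ↭-refl; ↭-reflexive; ↭-sym; ↭-trans; ↭-prep; ↭-swap)
open import Data.List.Relation.Binary.Permutation.Propositional.Properties using (∈-resp-↭; ↭-length; ↭-empty-inv; drop-∷; filter-↭; ++⁺ˡ; ++⁺ʳ; ∷↭∷ʳ)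
open import Data.Maybe using (just; nothing)
open import Data.Product using (_,_; ∃-syntax)
open import Data.Sum using (_⊎_; inj₁; inj₂)
open import Data.Vec using (Vec; []; _∷_)
open import Data.Vec.Properties using (∷-injectiveˡ; ∷-injectiveʳ)
open import Data.Vec.Relation.Unary.All using (All; []; _∷_)
open import Function using (_∘_)
open import Relation.Binary.PropositionalEquality as ≡ using (_≡_; _≢_; refl; cong; cong₂; subst₂)
open import Relation.Nullary using (¬_; yes; no; contradiction)

removePart-just : ∀ i p {q} → removePart i p ≡ just q → p ↭ i ∷ q
removePart-just i (x ∷ xs) eq with i ≟ x
removePart-just i (.i ∷ xs) refl | yes refl = ↭-refl
... | no _ with removePart i xs in eq′
removePart-just i (x ∷ xs) refl | no _ | just ys =
  ↭-trans (↭-prep x (removePart-just i xs eq′)) (↭-swap x i ↭-refl)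

removePart-nothing : ∀ i p → removePart i p ≡ nothing → i ∉ p
removePart-nothing i (x ∷ xs) eq with i ≟ x
removePart-nothing i (x ∷ xs) () | yes _
... | no i≢x with removePart i xs in eq′
removePart-nothing i (x ∷ xs) refl | no i≢x | nothing = λ
  { (here i≡x)   → i≢x i≡x
  ; (there i∈xs) → removePart-nothing i xs eq′ i∈xs
  }

++-cancelˡ-↭ : ∀ {a} {A : Set a} (xs : List A) {ys zs} → xs ++ ys ↭ xs ++ zs → ys ↭ zs
++-cancelˡ-↭ []       h = h
++-cancelˡ-↭ (x ∷ xs) h = ++-cancelˡ-↭ xs (drop-∷ h)

allPairs-replicate : ∀ {a r} {A : Set a} {R : A → A → Set r} {x} → R x x → ∀ k → AllPairs R (replicate k x)
allPairs-replicate Rxx zero    = []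
allPairs-replicate Rxx (suc k) = replicate⁺ k Rxx ∷ allPairs-replicate Rxx k

concatMap-concatMap : ∀ {a b c} {A : Set a} {B : Set b} {C : Set c} (f : B → List C) (g : A → List B) xs →
                      concatMap f (concatMap g xs) ≡ concatMap (concatMap f ∘ g) xs
concatMap-concatMap f g []       = refl
concatMap-concatMap f g (x ∷ xs) =
  ≡.trans (concatMap-++ f (g x) (concatMap g xs)) (cong (concatMap f (g x) ++_) (concatMap-concatMap f g xs))

fromMultiplicities : ∀ {n} → ℕ → Vec ℕ n → Partition
fromMultiplicities j []      = []
fromMultiplicities j (a ∷ α) = fromMultiplicities (suc j) α ++ replicate a j

fromMultiplicities-≥ : ∀ {n} j (α : Vec ℕ n) → ListAll.All (j ≤_) (fromMultiplicities j α)
fromMultiplicities-≥ j []      = []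
fromMultiplicities-≥ j (a ∷ α) = ++⁺ (ListAll.map <⇒≤ (fromMultiplicities-≥ (suc j) α)) (replicate⁺ a ≤-refl)

fromMultiplicities-sorted : ∀ {n} j (α : Vec ℕ n) → AllPairs _≥_ (fromMultiplicities j α)
fromMultiplicities-sorted j []      = []
fromMultiplicities-sorted j (a ∷ α) =
  AllPairs.++⁺ (fromMultiplicities-sorted (suc j) α) (allPairs-replicate ≤-refl a)
    (ListAll.map (λ j<x → replicate⁺ a (<⇒≤ j<x)) (fromMultiplicities-≥ (suc j) α))

fromMultiplicities-isPartition : ∀ {n} (α : Vec ℕ n) → IsPartition (fromMultiplicities 1 α)
fromMultiplicities-isPartition α = fromMultiplicities-≥ 1 α , AllPairs⇒Linked (fromMultiplicities-sorted 1 α)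

filter-<-fromMultiplicities : ∀ {n} j a (α : Vec ℕ n) →
                              filter (j <?_) (fromMultiplicities j (a ∷ α)) ≡ fromMultiplicities (suc j) α
filter-<-fromMultiplicities j a α = begin
  filter (j <?_) (fromMultiplicities (suc j) α ++ replicate a j)
    ≡⟨ filter-++ (j <?_) (fromMultiplicities (suc j) α) (replicate a j) ⟩
  filter (j <?_) (fromMultiplicities (suc j) α) ++ filter (j <?_) (replicate a j)
    ≡⟨ cong₂ _++_ (filter-all (j <?_) (fromMultiplicities-≥ (suc j) α)) (filter-none (j <?_) (replicate⁺ a (n≮n j))) ⟩
  fromMultiplicities (suc j) α ++ []
    ≡⟨ ++-identityʳ _ ⟩
  fromMultiplicities (suc j) α ∎
  where open ≡.≡-Reasoning

fromMultiplicities-injective : ∀ {n} j {α β : Vec ℕ n} → fromMultiplicities j α ↭ fromMultiplicities j β → α ≡ β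
fromMultiplicities-injective j {[]}    {[]}    _ = refl
fromMultiplicities-injective j {a ∷ α} {b ∷ β} h
  with refl ← fromMultiplicities-injective (suc j) {α} {β}
                (subst₂ _↭_ (filter-<-fromMultiplicities j a α) (filter-<-fromMultiplicities j b β) (filter-↭ (j <?_) h))
  = cong (_∷ α) (≡.trans (≡.sym (length-replicate a)) (≡.trans (↭-length replicates↭) (length-replicate b)))
  where
  replicates↭ : replicate a j ↭ replicate b j
  replicates↭ = ++-cancelˡ-↭ (fromMultiplicities (suc j) α) h

module CharZeroFieldProperties {c ℓ} (F : CharZeroField c ℓ) where
  open CharZeroField F renaming (refl to ≈-refl; sym to ≈-sym; trans to ≈-trans)
  open import Relation.Binary.Reasoning.Setoid setoid

  x*y≈0⇒x≈0 : ∀ {x y} → ¬ y ≈ 0# → x * y ≈ 0# → x ≈ 0#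
  x*y≈0⇒x≈0 {x} {y} y≉0 xy≈0 with y′ , yy′≈1 ← inverse y y≉0 = begin
    x              ≈⟨ *-identityʳ x ⟨
    x * 1#         ≈⟨ *-congˡ yy′≈1 ⟨
    x * (y * y′)   ≈⟨ *-assoc x y y′ ⟨
    (x * y) * y′   ≈⟨ *-congʳ xy≈0 ⟩
    0# * y′        ≈⟨ zeroˡ y′ ⟩
    0#             ∎

  *-≉0 : ∀ {x y} → ¬ x ≈ 0# → ¬ y ≈ 0# → ¬ x * y ≈ 0#
  *-≉0 x≉0 y≉0 = x≉0 ∘ x*y≈0⇒x≈0 y≉0

  1#≉0 : ¬ 1# ≈ 0#
  1#≉0 1≈0 = charZero 0 (≈-trans (+-identityʳ 1#) 1≈0)

  fromℕ≉0 : ∀ k → .{{NonZero k}} → ¬ fromℕ k ≈ 0#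
  fromℕ≉0 (suc k) = charZero k

module SymFunProperties {c ℓ} (F : CharZeroField c ℓ) where
  open CharZeroField F renaming (refl to ≈-refl; sym to ≈-sym; trans to ≈-trans)
  open SymFun F
  open CharZeroFieldProperties F
  open import Relation.Binary.Reasoning.Setoid setoid

  -- Removal p r x: either x = a · m_q with a ≠ 0 and p = r ⊎ q as multisets, or x = 0 and r is
  -- not a sub-multiset of p.  This is the shape of D_{r₁} ⋯ D_{r_k} m_p.
  data Removal (p r : Partition) : Λ → Set (c ⊔ ℓ) where
    vanishes : ¬ (∃[ q ] p ↭ r ++ q) → Removal p r []
    survives : ∀ {a q} → ¬ a ≈ 0# → p ↭ r ++ q → Removal p r ((a , q) ∷ [])

  removal-resp-↭ : ∀ {p r r′ x} → r ↭ r′ → Removal p r x → Removal p r′ x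
  removal-resp-↭ r↭r′ (vanishes r⊈p)   = vanishes λ (q , h) → r⊈p (q , ↭-trans h (++⁺ʳ q (↭-sym r↭r′)))
  removal-resp-↭ r↭r′ (survives a≉0 h) = survives a≉0 (↭-trans h (++⁺ʳ _ r↭r′))

  removal-then : ∀ {p r s x} (f : Λ → Λ) → f [] ≡ [] →
                 (∀ {a} q → ¬ a ≈ 0# → Removal q s (f ((a , q) ∷ []))) →
                 Removal p r x → Removal p (r ++ s) (f x)
  removal-then {r = r} {s} _ f[]≡[] _ (vanishes r⊈p) rewrite f[]≡[] =
    vanishes λ (q , h) → r⊈p (s ++ q , ↭-trans h (↭-reflexive (++-assoc r s q)))
  removal-then {r = r} {s} f _ removal (survives {a} {q} a≉0 p↭rq)
    with f ((a , q) ∷ []) | removal q a≉0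
  ... | _ | vanishes s⊈q =
    vanishes λ (q′ , h) → s⊈q (q′ , ++-cancelˡ-↭ r (↭-trans (↭-sym p↭rq) (↭-trans h (↭-reflexive (++-assoc r s q′)))))
  ... | _ | survives b≉0 q↭sq′ =
    survives b≉0 (↭-trans p↭rq (↭-trans (++⁺ˡ r q↭sq′) (↭-reflexive (≡.sym (++-assoc r s _)))))

  D-removal : ∀ i {a} p → ¬ a ≈ 0# → Removal p [ i ] (D i ((a , p) ∷ []))
  D-removal i p a≉0 with removePart i p in eq
  ... | nothing = vanishes λ (q , p↭iq) → removePart-nothing i p eq (∈-resp-↭ (↭-sym p↭iq) (here refl))
  ... | just q  = survives (*-≉0 (fromℕ≉0 (i !) {{i !≢0}}) a≉0) (removePart-just i p eq)

  Dpow-[] : ∀ i k → Dpow i k [] ≡ []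
  Dpow-[] i zero    = refl
  Dpow-[] i (suc k) = cong (D i) (Dpow-[] i k)

  Dpow-removal : ∀ i k {a} p → ¬ a ≈ 0# → Removal p (replicate k i) (Dpow i k ((a , p) ∷ []))
  Dpow-removal i zero    p a≉0 = survives a≉0 ↭-refl
  Dpow-removal i (suc k) p a≉0 =
    removal-resp-↭ (↭-sym (∷↭∷ʳ i (replicate k i))) (removal-then (D i) refl (D-removal i) (Dpow-removal i k p a≉0))

  DmonoFrom-removal : ∀ {n} j (β : Vec ℕ n) {a} p → ¬ a ≈ 0# →
                      Removal p (fromMultiplicities j β) (DmonoFrom j β ((a , p) ∷ []))
  DmonoFrom-removal j []      p a≉0 = survives a≉0 ↭-refl
  DmonoFrom-removal j (b ∷ β) p a≉0 =
    removal-then (Dpow j b) (Dpow-[] j b) (Dpow-removal j b) (DmonoFrom-removal (suc j) β p a≉0)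

  coeff[]-removal : ∀ {p r x} → Removal p r x → coeff [] x ≈ 0# ⊎ p ↭ r
  coeff[]-removal (vanishes _)                 = inj₁ ≈-refl
  coeff[]-removal (survives {q = []} _ p↭r++[]) = inj₂ (↭-trans p↭r++[] (↭-reflexive (++-identityʳ _)))
  coeff[]-removal (survives {q = _ ∷ _} _ _)    = inj₁ ≈-refl

  coeff[]-removal-self : ∀ {p x} → Removal p p x → ¬ coeff [] x ≈ 0#
  coeff[]-removal-self {p} (vanishes p⊈p) = contradiction ([] , ↭-reflexive (≡.sym (++-identityʳ p))) p⊈p
  coeff[]-removal-self {p} (survives {a} {q} a≉0 p↭p++q)
    with refl ← ↭-empty-inv (↭-sym (++-cancelˡ-↭ p (↭-trans (↭-reflexive (++-identityʳ p)) p↭p++q)))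
    = a≉0 ∘ ≈-trans (≈-sym (+-identityʳ a))

  coeff-++ : ∀ μ xs ys → coeff μ (xs ++ ys) ≈ coeff μ xs + coeff μ ys
  coeff-++ μ []             ys = ≈-sym (+-identityˡ _)
  coeff-++ μ ((a , p) ∷ xs) ys with ≡-dec _≟_ p μ
  ... | yes _ = ≈-trans (+-congˡ (coeff-++ μ xs ys)) (≈-sym (+-assoc _ _ _))
  ... | no  _ = coeff-++ μ xs ys

  coeff-scale : ∀ μ a xs → coeff μ (scale a xs) ≈ a * coeff μ xs
  coeff-scale μ a []             = ≈-sym (zeroʳ a)
  coeff-scale μ a ((b , p) ∷ xs) with ≡-dec _≟_ p μ
  ... | yes _ = ≈-trans (+-congˡ (coeff-scale μ a xs)) (≈-sym (distribˡ a b _))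
  ... | no  _ = coeff-scale μ a xs

  coeff-concatMap-≈0 : ∀ {A : Set} μ (f : A → Λ) {xs} → ListAll.All (λ x → coeff μ (f x) ≈ 0#) xs →
                       coeff μ (concatMap f xs) ≈ 0#
  coeff-concatMap-≈0 μ f []         = ≈-refl
  coeff-concatMap-≈0 μ f {x ∷ xs} (fx≈0 ∷ rest) =
    ≈-trans (coeff-++ μ (f x) (concatMap f xs)) (≈-trans (+-cong fx≈0 (coeff-concatMap-≈0 μ f rest)) (+-identityʳ 0#))

  coeff-concatMap-unique : ∀ {A : Set} μ (f : A → Λ) {xs a} → Unique xs → a ∈ xs →
                           (∀ b → b ≢ a → coeff μ (f b) ≈ 0#) → coeff μ (concatMap f xs) ≈ coeff μ (f a)
  coeff-concatMap-unique μ f {x ∷ xs} (x∉xs ∷ _) (here refl) others = begin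
    coeff μ (f x ++ concatMap f xs)          ≈⟨ coeff-++ μ (f x) (concatMap f xs) ⟩
    coeff μ (f x) + coeff μ (concatMap f xs) ≈⟨ +-congˡ (coeff-concatMap-≈0 μ f (ListAll.map (λ x≢y → others _ (x≢y ∘ ≡.sym)) x∉xs)) ⟩
    coeff μ (f x) + 0#                       ≈⟨ +-identityʳ _ ⟩
    coeff μ (f x)                            ∎
  coeff-concatMap-unique μ f {x ∷ xs} {a} (x∉xs ∷ unique) (there a∈xs) others = begin
    coeff μ (f x ++ concatMap f xs)          ≈⟨ coeff-++ μ (f x) (concatMap f xs) ⟩
    coeff μ (f x) + coeff μ (concatMap f xs) ≈⟨ +-cong (others x (ListAll.lookup x∉xs a∈xs)) (coeff-concatMap-unique μ f unique a∈xs others) ⟩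
    0# + coeff μ (f a)                       ≈⟨ +-identityˡ _ ⟩
    coeff μ (f a)                            ∎

  coeff-concatMap-box : ∀ μ {n d} (f : Vec ℕ n → Λ) {α} → All (_≤ d) α →
                        (∀ β → β ≢ α → coeff μ (f β) ≈ 0#) → coeff μ (concatMap f (box n d)) ≈ coeff μ (f α)
  coeff-concatMap-box μ {zero} f [] _ = ≈-trans (coeff-++ μ (f []) []) (+-identityʳ _)
  coeff-concatMap-box μ {suc n} {d} f {a ∷ α} (a≤d ∷ α≤d) others = begin
    coeff μ (concatMap f (concatMap (λ b → map (b ∷_) (box n d)) (upTo (suc d))))
      ≡⟨ cong (coeff μ) (≡.trans (concatMap-concatMap f (λ b → map (b ∷_) (box n d)) (upTo (suc d)))
                                 (concatMap-cong (λ b → concatMap-map f (b ∷_) (box n d)) (upTo (suc d)))) ⟩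
    coeff μ (concatMap (λ b → concatMap (f ∘ (b ∷_)) (box n d)) (upTo (suc d)))
      ≈⟨ coeff-concatMap-unique μ (λ b → concatMap (f ∘ (b ∷_)) (box n d)) (upTo⁺ (suc d)) (∈-upTo⁺ (s≤s a≤d)) offSlice ⟩
    coeff μ (concatMap (f ∘ (a ∷_)) (box n d))
      ≈⟨ coeff-concatMap-box μ (f ∘ (a ∷_)) α≤d (λ β β≢α → others (a ∷ β) (β≢α ∘ ∷-injectiveʳ)) ⟩
    coeff μ (f (a ∷ α)) ∎
    where
    offSlice : ∀ b → b ≢ a → coeff μ (concatMap (f ∘ (b ∷_)) (box n d)) ≈ 0#
    offSlice b b≢a = coeff-concatMap-≈0 μ (f ∘ (b ∷_)) {box n d} (ListAll.universal (λ β → others (b ∷ β) (b≢a ∘ ∷-injectiveˡ)) _)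

mainTheorem8 : ∀ {c ℓ} (F : CharZeroField c ℓ) →
  let open CharZeroField F
      open SymFun F
  in (n d : ℕ) (coef : Vec ℕ n → Carrier) →
     (∀ (λ′ : Partition) → IsPartition λ′ → ∀ (μ : Partition) →
        coeff μ (applyPoly n d coef (m λ′)) ≈ 0#) →
     ∀ (α : Vec ℕ n) → All (_≤ d) α → coef α ≈ 0#
mainTheorem8 F n d coef annihilates α α≤d = x*y≈0⇒x≈0 (coeff[]-removal-self (removal α)) (begin
  coef α * coeff [] (Dmono α (m pα))   ≈⟨ coeff-scale [] (coef α) (Dmono α (m pα)) ⟨
  coeff [] (term α)                    ≈⟨ coeff-concatMap-box [] term α≤d offDiagonal ⟨
  coeff [] (applyPoly n d coef (m pα)) ≈⟨ annihilates pα (fromMultiplicities-isPartition α) [] ⟩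
  0#                                   ∎)
  where
  open CharZeroField F renaming (refl to ≈-refl; sym to ≈-sym; trans to ≈-trans)
  open SymFun F
  open CharZeroFieldProperties F
  open SymFunProperties F
  open import Relation.Binary.Reasoning.Setoid setoid

  pα : Partition
  pα = fromMultiplicities 1 α

  term : Vec ℕ n → Λ
  term β = scale (coef β) (Dmono β (m pα))

  removal : ∀ β → Removal pα (fromMultiplicities 1 β) (Dmono β (m pα))
  removal β = DmonoFrom-removal 1 β pα 1#≉0

  offDiagonal : ∀ β → β ≢ α → coeff [] (term β) ≈ 0#
  offDiagonal β β≢α with coeff[]-removal (removal β)
  ... | inj₁ constant≈0 = ≈-trans (coeff-scale [] (coef β) (Dmono β (m pα))) (≈-trans (*-congˡ constant≈0) (zeroʳ _))
  ... | inj₂ pα↭pβ      = contradiction (≡.sym (fromMultiplicities-injective 1 pα↭pβ)) β≢α
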